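{- If $(L,B)$ is a completely regular locale, then $L$ has a completely regular basis.
   Context: Framework: constructive set theory CZF + RRS-$\bigcup$REA (intuitionistic logic, no Powerset, Restricted Separation only, Strong Collection). A locale $(L,B)$ is a pair of classes $(L,\le)$ with finite meets, joins of all subsets, $x\wedge\bigvee U=\bigvee_{y\in U}(x\wedge y)$, and a set $B\subseteq L$ (basis) such that for every $x$, $\{b\in B:b\le x\}$ is a set with join $x$; any set $B'\subseteq L$ containing a basis is a basis. $y^*=\bigvee\{c\in B:c\wedge y=0\}$; $y\prec x$ iff $1=x\vee y^*$. A scale from $y$ to $x$ is a map $s:\mathbb I\to L$ from the rational unit interval $\mathbb I=\mathbb Q\cap[0,1]$ with $s(0)=y$, $s(1)=x$, and $s(p)\prec s(q)$ for $p<q$. $(L,B)$ is completely regular if there is a family $ri:B\to\mathcal P(B)$ with $a=\bigvee ri(a)$ for all $a\in B$ and, for each $b\in ri(a)$, a scale from $b$ to $a$ exists. For a basis $B'$ and $a,b\in B'$, $b\prec\prec_{B'}a$ iff there is a scale from $b$ to $a$ all of whose values lie in $B'$; $B'$ is a completely regular basis if $a=\bigvee\{b\in B':b\prec\prec_{B'}a\}$ for all $a\in B'$. -}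

module Defs where

open import Data.Bool using (Bool; true; false; if_then_else_)
open import Data.Empty using (⊥; ⊥-elim)
open import Data.Product using (Σ; _×_; _,_; proj₁; proj₂)
open import Data.Rational using (ℚ; 0ℚ; 1ℚ) renaming (_≤_ to _≤ℚ_; _<_ to _<ℚ_)
open import Relation.Binary.PropositionalEquality using (_≡_)

-- Classes are modelled as types in Set₁, sets as types in
-- Set.  Subsets of L that are sets are Set-indexed families I → L.
-- Equality of elements of L is the order-induced equivalence _≈_.
record Locale : Set₂ where
  infix 4 _≤_
  infixr 7 _∧_
  field
    Carrier  : Set₁
    _≤_      : Carrier → Carrier → Set
    ≤-refl   : ∀ x → x ≤ x
    ≤-trans  : ∀ {x y z} → x ≤ y → y ≤ z → x ≤ z
    ⊤        : Carrier
    ⊤-max    : ∀ x → x ≤ ⊤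
    _∧_      : Carrier → Carrier → Carrier
    ∧-lb₁    : ∀ x y → x ∧ y ≤ x
    ∧-lb₂    : ∀ x y → x ∧ y ≤ y
    ∧-glb    : ∀ {x y z} → z ≤ x → z ≤ y → z ≤ x ∧ y
    ⋁        : {I : Set} → (I → Carrier) → Carrier
    ⋁-ub     : ∀ {I} (f : I → Carrier) (i : I) → f i ≤ ⋁ f
    ⋁-lub    : ∀ {I} (f : I → Carrier) (x : Carrier) → (∀ i → f i ≤ x) → ⋁ f ≤ x
    -- x ∧ ⋁ U = ⋁_{y ∈ U} (x ∧ y)  (the other inequality is automatic)
    distrib  : ∀ x {I} (f : I → Carrier) → x ∧ ⋁ f ≤ ⋁ (λ i → x ∧ f i)
    BIdx     : Set
    basis    : BIdx → Carrier
    basis-join : ∀ x → x ≤ ⋁ {Σ BIdx (λ b → basis b ≤ x)} (λ p → basis (proj₁ p))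

module _ (𝓛 : Locale) where
  open Locale 𝓛

  _≈_ : Carrier → Carrier → Set
  x ≈ y = (x ≤ y) × (y ≤ x)

  𝟘 : Carrier
  𝟘 = ⋁ {⊥} ⊥-elim

  _∨_ : Carrier → Carrier → Carrier
  x ∨ y = ⋁ {Bool} (λ b → if b then x else y)

  pseudo : Carrier → Carrier
  pseudo y = ⋁ {Σ BIdx (λ c → (basis c ∧ y) ≈ 𝟘)} (λ p → basis (proj₁ p))

  _≺_ : Carrier → Carrier → Set
  y ≺ x = ⊤ ≈ (x ∨ pseudo y)

  𝕀 : Set
  𝕀 = Σ ℚ (λ q → (0ℚ ≤ℚ q) × (q ≤ℚ 1ℚ))

  IsScale : (𝕀 → Carrier) → Carrier → Carrier → Set
  IsScale s y x =
    (∀ p → proj₁ p ≡ 0ℚ → s p ≈ y) ×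
    (∀ p → proj₁ p ≡ 1ℚ → s p ≈ x) ×
    (∀ p q → proj₁ p <ℚ proj₁ q → s p ≺ s q)

  -- (L , B) completely regular: a family ri : B → P(B)
  CompletelyRegular : Set₁
  CompletelyRegular =
    Σ (BIdx → BIdx → Set) λ ri →
      (∀ a → basis a ≈ ⋁ {Σ BIdx (ri a)} (λ p → basis (proj₁ p))) ×
      (∀ a b → ri a b → Σ (𝕀 → Carrier) λ s → IsScale s (basis b) (basis a))

  IsBasis : {B' : Set} → (B' → Carrier) → Set₁
  IsBasis {B'} ι = ∀ x → x ≈ ⋁ {Σ B' (λ b → ι b ≤ x)} (λ p → ι (proj₁ p))

  ≺≺[_] : {B' : Set} → (B' → Carrier) → B' → B' → Set
  ≺≺[_] {B'} ι b a = Σ (𝕀 → B') λ s →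
    (∀ p → proj₁ p ≡ 0ℚ → ι (s p) ≈ ι b) ×
    (∀ p → proj₁ p ≡ 1ℚ → ι (s p) ≈ ι a) ×
    (∀ p q → proj₁ p <ℚ proj₁ q → ι (s p) ≺ ι (s q))

  IsCompletelyRegularBasis : {B' : Set} → (B' → Carrier) → Set₁
  IsCompletelyRegularBasis {B'} ι =
    IsBasis ι ×
    (∀ a → ι a ≈ ⋁ {Σ B' (λ b → ≺≺[ ι ] b a)} (λ p → ι (proj₁ p)))

module Submission where

-- Enlarge the basis B by the values of all the given scales.  A scale s from
-- b to a is first replaced by its lower regularisation
--   t r = ⋁ { s q : q < r } ∨ s 0   (and ∨ s 1 when r = 1),
-- which is still a scale from b to a but moreover has t r = ⋁_{m < r} t m
-- for 0 < r < 1.  A value t m with m < r is ≺≺-below t r, witnessed by t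
-- reparametrised affinely from [m , r] onto [0 , 1]; so every interior value
-- is covered by ≺≺-smaller ones.  The values t 0 = b and t 1 = a, as well as
-- the basic elements, are covered using ri and the scales themselves.

open import Defs
open import Data.Bool using (true; false)
open import Data.Empty using (⊥-elim)
open import Data.Product using (Σ; _×_; _,_; proj₁; proj₂)
open import Data.Sum using (_⊎_; inj₁; inj₂)
open import Function using (_∘_)
open import Relation.Binary.Definitions using (tri<; tri≈; tri>)
open import Relation.Binary.PropositionalEquality using (_≡_; refl; sym; trans; subst; cong)
open import Data.Rational using (ℚ; 0ℚ; 1ℚ; _+_; _*_; -_; _-_; Positive; NonNegative; positive)
  renaming (_≤_ to _≤ℚ_; _<_ to _<ℚ_)
import Data.Rational.Properties as ℚ

0<1 : 0ℚ <ℚ 1ℚ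
0<1 = ℚ.positive⁻¹ 1ℚ

module Lerp {m p : ℚ} (m<p : m <ℚ p) where

  private
    0<p-m : 0ℚ <ℚ p - m
    0<p-m = subst (_<ℚ p - m) (ℚ.+-inverseʳ m) (ℚ.+-monoˡ-< (- m) m<p)

    instance
      p-m-positive : Positive (p - m)
      p-m-positive = positive 0<p-m

      p-m-nonNegative : NonNegative (p - m)
      p-m-nonNegative = ℚ.pos⇒nonNeg (p - m)

  lerp : ℚ → ℚ
  lerp r = m + r * (p - m)

  lerp-mono-≤ : ∀ {r r'} → r ≤ℚ r' → lerp r ≤ℚ lerp r'
  lerp-mono-≤ r≤r' = ℚ.+-monoʳ-≤ m (ℚ.*-monoʳ-≤-nonNeg (p - m) r≤r')

  lerp-mono-< : ∀ {r r'} → r <ℚ r' → lerp r <ℚ lerp r'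
  lerp-mono-< r<r' = ℚ.+-monoʳ-< m (ℚ.*-monoˡ-<-pos (p - m) r<r')

  lerp-0 : lerp 0ℚ ≡ m
  lerp-0 = trans (cong (m +_) (ℚ.*-zeroˡ (p - m))) (ℚ.+-identityʳ m)

  lerp-1 : lerp 1ℚ ≡ p
  lerp-1 = begin
    m + 1ℚ * (p - m)  ≡⟨ cong (m +_) (ℚ.*-identityˡ (p - m)) ⟩
    m + (p - m)       ≡⟨ ℚ.+-comm m (p - m) ⟩
    p - m + m         ≡⟨ ℚ.+-assoc p (- m) m ⟩
    p + (- m + m)     ≡⟨ cong (p +_) (ℚ.+-inverseˡ m) ⟩
    p + 0ℚ            ≡⟨ ℚ.+-identityʳ p ⟩
    p                 ∎
    where open Relation.Binary.PropositionalEquality.≡-Reasoning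

module LocaleProperties (𝓛 : Locale) where
  open Locale 𝓛

  ≈-refl : ∀ {x} → _≈_ 𝓛 x x
  ≈-refl {x} = ≤-refl x , ≤-refl x

  ≈-sym : ∀ {x y} → _≈_ 𝓛 x y → _≈_ 𝓛 y x
  ≈-sym (x≤y , y≤x) = y≤x , x≤y

  ≈-trans : ∀ {x y z} → _≈_ 𝓛 x y → _≈_ 𝓛 y z → _≈_ 𝓛 x z
  ≈-trans (x≤y , y≤x) (y≤z , z≤y) = ≤-trans x≤y y≤z , ≤-trans z≤y y≤x

  ≡⇒≈ : ∀ {x y} → x ≡ y → _≈_ 𝓛 x y
  ≡⇒≈ refl = ≈-refl

  𝟘-min : ∀ x → 𝟘 𝓛 ≤ x
  𝟘-min x = ⋁-lub ⊥-elim x (λ ())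

  ∨-mono : ∀ {x x' y y'} → x ≤ x' → y ≤ y' → _∨_ 𝓛 x y ≤ _∨_ 𝓛 x' y'
  ∨-mono x≤x' y≤y' = ⋁-lub _ _ λ
    { true  → ≤-trans x≤x' (⋁-ub _ true)
    ; false → ≤-trans y≤y' (⋁-ub _ false) }

  pseudo-antitone : ∀ {y y'} → y' ≤ y → pseudo 𝓛 y ≤ pseudo 𝓛 y'
  pseudo-antitone y'≤y = ⋁-lub _ _ λ { (c , c∧y≈𝟘) →
    ⋁-ub _ (c , ≤-trans (∧-glb (∧-lb₁ _ _) (≤-trans (∧-lb₂ _ _) y'≤y)) (proj₁ c∧y≈𝟘) , 𝟘-min _) }

  ∧-pseudo≤𝟘 : ∀ y → y ∧ pseudo 𝓛 y ≤ 𝟘 𝓛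
  ∧-pseudo≤𝟘 y = ≤-trans (distrib y _) (⋁-lub _ _ λ { (c , c∧y≈𝟘) →
    ≤-trans (∧-glb (∧-lb₂ _ _) (∧-lb₁ _ _)) (proj₁ c∧y≈𝟘) })

  ≺-resp-≤ : ∀ {x x' y y'} → y' ≤ y → _≺_ 𝓛 y x → x ≤ x' → _≺_ 𝓛 y' x'
  ≺-resp-≤ y'≤y y≺x x≤x' = ≤-trans (proj₁ y≺x) (∨-mono x≤x' (pseudo-antitone y'≤y)) , ⊤-max _

  -- y = y ∧ (x ∨ y*) ≤ (y ∧ x) ∨ (y ∧ y*) ≤ x ∨ 𝟘
  ≺⇒≤ : ∀ {x y} → _≺_ 𝓛 y x → y ≤ x
  ≺⇒≤ {x} {y} y≺x =
    ≤-trans (∧-glb (≤-refl y) (≤-trans (⊤-max y) (proj₁ y≺x)))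
    (≤-trans (distrib y _) (⋁-lub _ _ λ
      { true  → ∧-lb₂ y x
      ; false → ≤-trans (∧-pseudo≤𝟘 y) (𝟘-min x) }))

  0𝕀 : 𝕀 𝓛
  0𝕀 = 0ℚ , ℚ.≤-refl , ℚ.<⇒≤ 0<1

  1𝕀 : 𝕀 𝓛
  1𝕀 = 1ℚ , ℚ.<⇒≤ 0<1 , ℚ.≤-refl

  IsIncreasing : (𝕀 𝓛 → Carrier) → Set
  IsIncreasing s = ∀ p q → proj₁ p <ℚ proj₁ q → _≺_ 𝓛 (s p) (s q)

  module _ {B' : Set} (ι : B' → Carrier) where

    IsBasis-⊇ : (j : BIdx → B') → (∀ c → _≈_ 𝓛 (ι (j c)) (basis c)) → IsBasis 𝓛 ι
    IsBasis-⊇ j ιj≈basis x =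
        ≤-trans (basis-join x) (⋁-lub _ _ λ { (c , c≤x) →
          ≤-trans (proj₂ (ιj≈basis c)) (⋁-ub _ (j c , ≤-trans (proj₁ (ιj≈basis c)) c≤x)) })
      , ⋁-lub _ _ proj₂

    ≺≺⇒≤ : ∀ {b a} → ≺≺[_] 𝓛 ι b a → ι b ≤ ι a
    ≺≺⇒≤ (s , s0≈b , s1≈a , s-inc) =
      ≤-trans (proj₂ (s0≈b 0𝕀 refl)) (≤-trans (≺⇒≤ (s-inc 0𝕀 1𝕀 0<1)) (proj₁ (s1≈a 1𝕀 refl)))

    -- The hypothesis on g makes up for 𝕀 carrying proofs alongside its
    -- rational, which the reparametrisation does not preserve.
    ≺≺-reparametrise :
      (g : 𝕀 𝓛 → B') → (∀ {x y} → proj₁ x ≡ proj₁ y → _≈_ 𝓛 (ι (g x)) (ι (g y))) →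
      IsIncreasing (ι ∘ g) →
      ∀ {m p b a} → proj₁ m <ℚ proj₁ p →
      _≈_ 𝓛 (ι (g m)) (ι b) → _≈_ 𝓛 (ι (g p)) (ι a) → ≺≺[_] 𝓛 ι b a
    ≺≺-reparametrise g g-ext g-inc {m} {p} m<p gm≈b gp≈a =
        g ∘ φ
      , (λ x x≡0 → ≈-trans (g-ext (trans (cong lerp x≡0) lerp-0)) gm≈b)
      , (λ x x≡1 → ≈-trans (g-ext (trans (cong lerp x≡1) lerp-1)) gp≈a)
      , (λ x y x<y → g-inc (φ x) (φ y) (lerp-mono-< x<y))
      where
      open Lerp m<p
      φ : 𝕀 𝓛 → 𝕀 𝓛
      φ (r , 0≤r , r≤1) =
          lerp r
        , ℚ.≤-trans (proj₁ (proj₂ m)) (subst (_≤ℚ lerp r) lerp-0 (lerp-mono-≤ 0≤r))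
        , ℚ.≤-trans (subst (lerp r ≤ℚ_) lerp-1 (lerp-mono-≤ r≤1)) (proj₂ (proj₂ p))

module LowerRegularisation (𝓛 : Locale) {b a : Locale.Carrier 𝓛}
  (s : 𝕀 𝓛 → Locale.Carrier 𝓛) (s-scale : IsScale 𝓛 s b a) where
  open Locale 𝓛
  open LocaleProperties 𝓛

  private
    s0≈b = proj₁ s-scale
    s1≈a = proj₁ (proj₂ s-scale)
    s-inc = proj₂ (proj₂ s-scale)

  Contributes : 𝕀 𝓛 → ℚ → Set
  Contributes q r = (proj₁ q <ℚ r) ⊎ ((proj₁ q ≡ 0ℚ) ⊎ ((proj₁ q ≡ 1ℚ) × (r ≡ 1ℚ)))

  lower : ℚ → Carrier
  lower r = ⋁ {Σ (𝕀 𝓛) (λ q → Contributes q r)} (s ∘ proj₁)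

  s≤lower : ∀ {r} q → Contributes q r → s q ≤ lower r
  s≤lower q q-contributes = ⋁-ub (s ∘ proj₁) (q , q-contributes)

  lower≤s : ∀ {r} → 0ℚ ≤ℚ r → r <ℚ 1ℚ → ∀ m → r <ℚ proj₁ m → lower r ≤ s m
  lower≤s 0≤r r<1 m r<m = ⋁-lub _ _ λ
    { (q , inj₁ q<r)              → ≺⇒≤ (s-inc q m (ℚ.<-trans q<r r<m))
    ; (q , inj₂ (inj₁ q≡0))       → ≺⇒≤ (s-inc q m (subst (_<ℚ proj₁ m) (sym q≡0) (ℚ.≤-<-trans 0≤r r<m)))
    ; (q , inj₂ (inj₂ (_ , r≡1))) → ⊥-elim (ℚ.<-irrefl r≡1 r<1) }

  lower-0 : _≈_ 𝓛 (lower 0ℚ) b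
  lower-0 = ⋁-lub _ _ (λ
      { (q , inj₁ q<0)              → ⊥-elim (ℚ.<-irrefl refl (ℚ.≤-<-trans (proj₁ (proj₂ q)) q<0))
      ; (q , inj₂ (inj₁ q≡0))       → proj₁ (s0≈b q q≡0)
      ; (q , inj₂ (inj₂ (_ , 0≡1))) → ⊥-elim (ℚ.<⇒≢ 0<1 0≡1) })
    , ≤-trans (proj₂ (s0≈b 0𝕀 refl)) (s≤lower 0𝕀 (inj₂ (inj₁ refl)))

  lower-1 : _≈_ 𝓛 (lower 1ℚ) a
  lower-1 = ⋁-lub _ _ (λ
      { (q , inj₁ q<1)              → s<1≤a q q<1
      ; (q , inj₂ (inj₁ q≡0))       → s<1≤a q (subst (_<ℚ 1ℚ) (sym q≡0) 0<1)
      ; (q , inj₂ (inj₂ (q≡1 , _))) → proj₁ (s1≈a q q≡1) })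
    , ≤-trans (proj₂ (s1≈a 1𝕀 refl)) (s≤lower 1𝕀 (inj₂ (inj₂ (refl , refl))))
    where
    s<1≤a : ∀ q → proj₁ q <ℚ 1ℚ → s q ≤ a
    s<1≤a q q<1 = ≤-trans (≺⇒≤ (s-inc q 1𝕀 q<1)) (proj₁ (s1≈a 1𝕀 refl))

  lower-leftContinuous : ∀ {r x} → 0ℚ <ℚ r → r <ℚ 1ℚ →
    (∀ m → proj₁ m <ℚ r → lower (proj₁ m) ≤ x) → lower r ≤ x
  lower-leftContinuous {r} {x} 0<r r<1 lower<r≤x = ⋁-lub _ _ λ
    { (q , inj₁ q<r)              → below q q<r
    ; (q , inj₂ (inj₁ q≡0))       → below q (subst (_<ℚ r) (sym q≡0) 0<r)
    ; (q , inj₂ (inj₂ (_ , r≡1))) → ⊥-elim (ℚ.<-irrefl r≡1 r<1) }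
    where
    below : ∀ q → proj₁ q <ℚ r → s q ≤ x
    below q q<r with ℚ.<-dense q<r
    ... | m , q<m , m<r = ≤-trans (s≤lower q (inj₁ q<m)) (lower<r≤x μ m<r)
      where
      μ : 𝕀 𝓛
      μ = m , ℚ.<⇒≤ (ℚ.≤-<-trans (proj₁ (proj₂ q)) q<m) , ℚ.<⇒≤ (ℚ.<-trans m<r r<1)

  -- lower r ≤ s m₁ ≺ s m₂ ≤ lower r'  for  r < m₁ < m₂ < r'
  lower-increasing : IsIncreasing (lower ∘ proj₁)
  lower-increasing (r , 0≤r , _) (r' , _ , r'≤1) r<r'
    with ℚ.<-dense r<r'
  ... | m₁ , r<m₁ , m₁<r' with ℚ.<-dense m₁<r'
  ... | m₂ , m₁<m₂ , m₂<r' =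
    ≺-resp-≤ (lower≤s 0≤r (ℚ.<-≤-trans r<r' r'≤1) μ₁ r<m₁) (s-inc μ₁ μ₂ m₁<m₂) (s≤lower μ₂ (inj₁ m₂<r'))
    where
    μ₁ μ₂ : 𝕀 𝓛
    μ₁ = m₁ , ℚ.<⇒≤ (ℚ.≤-<-trans 0≤r r<m₁) , ℚ.<⇒≤ (ℚ.<-≤-trans (ℚ.<-trans m₁<m₂ m₂<r') r'≤1)
    μ₂ = m₂ , ℚ.<⇒≤ (ℚ.≤-<-trans 0≤r (ℚ.<-trans r<m₁ m₁<m₂)) , ℚ.<⇒≤ (ℚ.<-≤-trans m₂<r' r'≤1)

module CompletelyRegularBasis (𝓛 : Locale) (cr : CompletelyRegular 𝓛) where
  open Locale 𝓛
  open LocaleProperties 𝓛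

  private
    ri = proj₁ cr
    ri-join = proj₁ (proj₂ cr)
    ri-scale = proj₂ (proj₂ cr)

  RiPair : Set
  RiPair = Σ BIdx (λ a → Σ BIdx (ri a))

  module Scale ((a , b , b∈ri) : RiPair) =
    LowerRegularisation 𝓛 (proj₁ (ri-scale a b b∈ri)) (proj₂ (ri-scale a b b∈ri))

  B⁺ : Set
  B⁺ = BIdx ⊎ (RiPair × 𝕀 𝓛)

  ι : B⁺ → Carrier
  ι (inj₁ c)       = basis c
  ι (inj₂ (τ , p)) = Scale.lower τ (proj₁ p)

  approx : B⁺ → Carrier
  approx e = ⋁ {Σ B⁺ (λ d → ≺≺[_] 𝓛 ι d e)} (ι ∘ proj₁)

  ≺≺⇒≤approx : ∀ d e → ≺≺[_] 𝓛 ι d e → ι d ≤ approx e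
  ≺≺⇒≤approx d e d≺≺e = ⋁-ub (ι ∘ proj₁) (d , d≺≺e)

  approx≤ : ∀ e → approx e ≤ ι e
  approx≤ e = ⋁-lub _ _ λ { (d , d≺≺e) → ≺≺⇒≤ ι {d} {e} d≺≺e }

  ≺≺-along : (τ : RiPair) → ∀ {m p} d e → proj₁ m <ℚ proj₁ p →
    _≈_ 𝓛 (Scale.lower τ (proj₁ m)) (ι d) → _≈_ 𝓛 (Scale.lower τ (proj₁ p)) (ι e) →
    ≺≺[_] 𝓛 ι d e
  ≺≺-along τ {m} {p} d e = ≺≺-reparametrise ι (λ q → inj₂ (τ , q))
    (λ r≡r' → ≡⇒≈ (cong (Scale.lower τ) r≡r')) (Scale.lower-increasing τ) {m} {p} {d} {e}

  ≤approx-basic : ∀ e c → _≈_ 𝓛 (ι e) (basis c) → ι e ≤ approx e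
  ≤approx-basic e c e≈c = ≤-trans (proj₁ e≈c) (≤-trans (proj₁ (ri-join c)) (⋁-lub _ _ λ
    { (d , d∈ri) → ≺≺⇒≤approx (inj₁ d) e
        (≺≺-along (c , d , d∈ri) {0𝕀} {1𝕀} (inj₁ d) e 0<1 (Scale.lower-0 (c , d , d∈ri))
          (≈-trans (Scale.lower-1 (c , d , d∈ri)) (≈-sym e≈c))) }))

  ≤approx-interior : ∀ τ p → 0ℚ <ℚ proj₁ p → proj₁ p <ℚ 1ℚ → ι (inj₂ (τ , p)) ≤ approx (inj₂ (τ , p))
  ≤approx-interior τ p 0<p p<1 = Scale.lower-leftContinuous τ 0<p p<1 λ m m<p →
    ≺≺⇒≤approx (inj₂ (τ , m)) (inj₂ (τ , p)) (≺≺-along τ {m} {p} (inj₂ (τ , m)) (inj₂ (τ , p)) m<p ≈-refl ≈-refl)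

  ≤approx : ∀ e → ι e ≤ approx e
  ≤approx (inj₁ c) = ≤approx-basic (inj₁ c) c ≈-refl
  ≤approx (inj₂ (τ@(a , b , _) , p@(r , 0≤r , r≤1))) with ℚ.<-cmp 0ℚ r | ℚ.<-cmp r 1ℚ
  ... | tri≈ _ 0≡r _ | _ = ≤approx-basic (inj₂ (τ , p)) b
                              (≈-trans (≡⇒≈ (cong (Scale.lower τ) (sym 0≡r))) (Scale.lower-0 τ))
  ... | _ | tri≈ _ r≡1 _ = ≤approx-basic (inj₂ (τ , p)) a
                              (≈-trans (≡⇒≈ (cong (Scale.lower τ) r≡1)) (Scale.lower-1 τ))
  ... | tri< 0<r _ _ | tri< r<1 _ _ = ≤approx-interior τ p 0<r r<1
  ... | tri> _ _ r<0 | _ = ⊥-elim (ℚ.<-irrefl refl (ℚ.<-≤-trans r<0 0≤r))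
  ... | _ | tri> _ _ 1<r = ⊥-elim (ℚ.<-irrefl refl (ℚ.<-≤-trans 1<r r≤1))

  isCompletelyRegularBasis : IsCompletelyRegularBasis 𝓛 ι
  isCompletelyRegularBasis = IsBasis-⊇ ι inj₁ (λ _ → ≈-refl) , λ e → ≤approx e , approx≤ e

lemma2p2 : (𝓛 : Locale) → CompletelyRegular 𝓛 →
    Σ Set (λ B' → Σ (B' → Locale.Carrier 𝓛) (λ ι → IsCompletelyRegularBasis 𝓛 ι))
lemma2p2 𝓛 cr = B⁺ , ι , isCompletelyRegularBasis
  where open CompletelyRegularBasis 𝓛 cr
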